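{- For every $n\ge 3$, every irreducible subcube partition of $\{0,1\}^n$ has size at most $\frac{2n-1}{3n-1}2^n$.
   Context: A subcube partition of length $n$ is a partition of $\{0,1\}^n$ into subcubes (sets obtained by fixing some coordinates to given bits); its size is the number of subcubes. It is irreducible if there is no subset $G$ with $1<|G|<|F|$ whose union is a subcube. -}

module Defs where

open import Data.Nat using (ℕ; suc; _<_)
open import Data.Bool using (Bool)
open import Data.Maybe using (Maybe; just; nothing)
open import Data.Vec using (Vec; []; _∷_)
open import Data.Fin using (Fin)
open import Data.Fin.Subset using (Subset; _∈_; ∣_∣)
open import Data.Product using (Σ; ∃; ∃-syntax; _×_)
open import Data.Unit using (⊤)
open import Relation.Binary.PropositionalEquality using (_≡_)
open import Relation.Nullary using (¬_)
open import Function.Bundles using (_⇔_)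

Point : ℕ → Set
Point n = Vec Bool n

-- A subcube of {0,1}^n: each coordinate is either fixed to a bit (just b)
-- or free (nothing, i.e. a star).
Subcube : ℕ → Set
Subcube n = Vec (Maybe Bool) n

_∈ᶜ_ : ∀ {n} → Point n → Subcube n → Set
[]      ∈ᶜ []             = ⊤
(x ∷ xs) ∈ᶜ (nothing ∷ c) = xs ∈ᶜ c
(x ∷ xs) ∈ᶜ (just b ∷ c)  = (x ≡ b) × (xs ∈ᶜ c)

Family : ℕ → ℕ → Set
Family n m = Fin m → Subcube n

IsSubcubePartition : ∀ {n m} → Family n m → Set
IsSubcubePartition {n} {m} F =
  ∀ (x : Point n) → Σ (Fin m) λ i → (x ∈ᶜ F i) × (∀ j → x ∈ᶜ F j → j ≡ i)

UnionIsSubcube : ∀ {n m} → Family n m → Subset m → Set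
UnionIsSubcube {n} {m} F G =
  ∃[ c ] (∀ (x : Point n) → (x ∈ᶜ c) ⇔ (∃[ i ] (i ∈ G × x ∈ᶜ F i)))

Irreducible : ∀ {n m} → Family n m → Set
Irreducible {n} {m} F =
  ∀ (G : Subset m) → 1 < ∣ G ∣ → ∣ G ∣ < m → ¬ UnionIsSubcube F G

-- Call a point x a singleton if its cell (the subcube of the partition containing it) is {x};
-- otherwise let i be the first free coordinate of the cell and call x lower or upper according
-- to x_i. With a, l, u the numbers of singletons, lowers and uppers, a + l + u = 2^n. Flipping
-- coordinate i maps lowers injectively to uppers, so l ≤ u, and the low corners of the m cells are
-- distinct singletons or lowers, so m ≤ a + l. When m ≥ 3, irreducibility forbids two adjacent
-- singletons (their union would be an edge), so each neighbour flip_j s of a singleton s lies in a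
-- cell whose first free coordinate i differs from j. Sending (s, j) to the lower end of the i-edge
-- through flip_j s, together with j with i punched out, is injective (two preimages of the same
-- pair would be adjacent singletons), whence a n ≤ l (n - 1). These three inequalities combine
-- linearly into m (3n - 1) ≤ (2n - 1) 2^n; for m ≤ 2 the bound is immediate.

module Submission where

open import Defs
open import Data.Nat using (ℕ; _≤_; _*_; _∸_; _^_)

open import Data.Bool using (Bool; true; false; not)
open import Data.Bool.Properties using (not-involutive; not-¬; ¬-not) renaming (_≟_ to _≟ᵇ_)
open import Data.Fin using (Fin; zero; suc; punchOut)
open import Data.Fin.Properties using (punchOut-injective) renaming (_≟_ to _≟ᶠ_)
open import Data.Fin.Subset using (Subset; ∣_∣; inside; outside; ⁅_⁆) renaming (_∈_ to _∈ˢ_; ⊥ to ∅)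
open import Data.Fin.Subset.Properties using (∣⁅x⁆∣≡1; x∈⁅x⁆; x∈⁅y⁆⇒x≡y; ∉⊥)
open import Data.List using (List; []; _∷_; _++_; [_]; length; filter; allFin; cartesianProduct; cartesianProductWith)
open import Data.List.Properties using (length-++; length-map; length-++-sucʳ; length-tabulate)
open import Data.List.Membership.Propositional using (_∈_)
open import Data.List.Membership.Propositional.Properties
  using (∈-∃++; ∈-++⁺ˡ; ∈-++⁺ʳ; ∈-filter⁺; ∈-filter⁻; ∈-allFin; ∈-cartesianProduct⁺; ∈-cartesianProduct⁻; ∈-cartesianProductWith⁺)
open import Data.List.Relation.Unary.All as All using ()
open import Data.List.Relation.Unary.Any using (here; there)
open import Data.List.Relation.Unary.AllPairs using ([]; _∷_)
open import Data.List.Relation.Unary.Unique.Propositional using (Unique)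
import Data.List.Relation.Unary.Unique.Propositional.Properties as Unique
open import Data.Maybe as Maybe using (Maybe; just; nothing; maybe′; fromMaybe)
open import Data.Maybe.Properties using (just-injective) renaming (≡-dec to ≡-decᵐ)
open import Data.Nat using (zero; suc; _+_; _<_; z≤n; s≤s)
open import Data.Nat.Properties
  using (+-suc; m≤m+n; _≤?_; ≰⇒>; +-monoʳ-≤; *-monoˡ-≤; *-monoʳ-≤; ^-monoʳ-≤; +-cancelʳ-≤; module ≤-Reasoning)
open import Data.Nat.Tactic.RingSolver using (solve)
open import Data.Product using (∃-syntax; _×_; _,_; proj₁; proj₂)
open import Data.Sum using (_⊎_; inj₁; inj₂) renaming (map to map⊎)
open import Data.Unit using (tt)
open import Data.Vec as Vec using ([]; _∷_; here; there; lookup; updateAt; _[_]≔_)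
open import Data.Vec.Properties
  using (∷-injective; ∷-injectiveʳ; lookup∘updateAt; lookup∘update; lookup-map; updateAt-updateAt-local; updateAt-id; updateAt-commutes)
open import Function using (id; const; _∘_; _∋_)
open import Function.Bundles using (mk⇔)
open import Relation.Binary.Definitions using (DecidableEquality)
open import Relation.Binary.PropositionalEquality using (_≡_; _≢_; refl; sym; trans; cong; cong₂; subst; subst₂)
open import Relation.Nullary using (yes; no; contradiction)

∈-remove-middle : ∀ {A : Set} {z w : A} (xs : List A) {ys} → z ∈ xs ++ w ∷ ys → z ≢ w → z ∈ xs ++ ys
∈-remove-middle []       (here z≡w)  z≢w = contradiction z≡w z≢w
∈-remove-middle []       (there z∈)  _   = z∈
∈-remove-middle (x ∷ xs) (here z≡x)  _   = here z≡x
∈-remove-middle (x ∷ xs) (there z∈)  z≢w = there (∈-remove-middle xs z∈ z≢w)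

injective⇒length-≤ : ∀ {A B : Set} (f : A → B) {xs : List A} {ys : List B} → Unique xs →
  (∀ {x y} → x ∈ xs → y ∈ xs → f x ≡ f y → x ≡ y) →
  (∀ {x} → x ∈ xs → f x ∈ ys) → length xs ≤ length ys
injective⇒length-≤ f {[]}     _          _   _    = z≤n
injective⇒length-≤ f {x ∷ xs} (x∉ ∷ xs!) inj into with ys₁ , ys₂ , refl ← ∈-∃++ (into (here refl)) =
  subst (suc (length xs) ≤_) (sym (length-++-sucʳ ys₁ (f x) ys₂))
    (s≤s (injective⇒length-≤ f xs! (λ p q → inj (there p) (there q)) into′))
  where
  into′ : ∀ {y} → y ∈ xs → f y ∈ ys₁ ++ ys₂
  into′ y∈ = ∈-remove-middle ys₁ (into (there y∈))
    (λ fy≡fx → All.lookup x∉ y∈ (sym (inj (there y∈) (here refl) fy≡fx)))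

length-cartesianProductWith : ∀ {A B C : Set} (f : A → B → C) xs ys →
  length (cartesianProductWith f xs ys) ≡ length xs * length ys
length-cartesianProductWith f []       ys = refl
length-cartesianProductWith f (x ∷ xs) ys = trans (length-++ (Data.List.map (f x) ys))
  (cong₂ _+_ (length-map (f x) ys) (length-cartesianProductWith f xs ys))

length-×-allFin : ∀ {A : Set} (xs : List A) {n} → length (cartesianProduct xs (allFin n)) ≡ length xs * n
length-×-allFin xs {n} = trans (length-cartesianProductWith _,_ xs (allFin n)) (cong (length xs *_) (length-tabulate id))

_≟ᵐ_ : DecidableEquality (Maybe Bool)
_≟ᵐ_ = ≡-decᵐ _≟ᵇ_

fibre : ∀ {A : Set} → (A → Maybe Bool) → Maybe Bool → List A → List A
fibre f v = filter (λ x → f x ≟ᵐ v)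

∈-fibre⁺ : ∀ {A : Set} {f : A → Maybe Bool} {v x xs} → x ∈ xs → f x ≡ v → x ∈ fibre f v xs
∈-fibre⁺ {f = f} {v} = ∈-filter⁺ (λ x → f x ≟ᵐ v)

∈-fibre⁻ : ∀ {A : Set} {f : A → Maybe Bool} {v x} xs → x ∈ fibre f v xs → f x ≡ v
∈-fibre⁻ {f = f} {v} xs x∈ = proj₂ (∈-filter⁻ (λ x → f x ≟ᵐ v) {xs = xs} x∈)

length-fibres : ∀ {A : Set} (f : A → Maybe Bool) xs →
  length (fibre f nothing xs) + length (fibre f (just false) xs) + length (fibre f (just true) xs)
    ≡ length xs
length-fibres f []       = refl
length-fibres f (x ∷ xs) with f x
... | nothing    = cong suc (length-fibres f xs)
... | just false = trans (cong (_+ length (fibre f (just true) xs)) (+-suc (length (fibre f nothing xs)) _))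
                         (cong suc (length-fibres f xs))
... | just true  = trans (+-suc _ _) (cong suc (length-fibres f xs))

bits : List Bool
bits = true ∷ false ∷ []

allPoints : ∀ n → List (Point n)
allPoints zero    = [ [] ]
allPoints (suc n) = cartesianProductWith _∷_ bits (allPoints n)

length-allPoints : ∀ n → length (allPoints n) ≡ 2 ^ n
length-allPoints zero    = refl
length-allPoints (suc n) = trans (length-cartesianProductWith _∷_ bits (allPoints n))
                                 (cong (2 *_) (length-allPoints n))

∈-allPoints : ∀ {n} (x : Point n) → x ∈ allPoints n
∈-allPoints []          = here refl
∈-allPoints (true ∷ x)  = ∈-cartesianProductWith⁺ _∷_ {xs = bits} (here refl) (∈-allPoints x)
∈-allPoints (false ∷ x) = ∈-cartesianProductWith⁺ _∷_ {xs = bits} (there (here refl)) (∈-allPoints x)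

allPoints-unique : ∀ n → Unique (allPoints n)
allPoints-unique zero    = All.[] ∷ []
allPoints-unique (suc n) = Unique.cartesianProductWith⁺ _∷_ ∷-injective
  (((λ ()) All.∷ All.[]) ∷ All.[] ∷ []) (allPoints-unique n)

flip : ∀ {n} → Fin n → Point n → Point n
flip i x = updateAt x i not

lookup-flip : ∀ {n} i (x : Point n) → lookup (flip i x) i ≡ not (lookup x i)
lookup-flip i x = lookup∘updateAt i x

flip-involutive : ∀ {n} i (x : Point n) → flip i (flip i x) ≡ x
flip-involutive i x = trans (updateAt-updateAt-local i x (not-involutive _)) (updateAt-id i x)

flip-injective : ∀ {n} i {x y : Point n} → flip i x ≡ flip i y → x ≡ y
flip-injective i {x} {y} eq = trans (sym (flip-involutive i x)) (trans (cong (flip i) eq) (flip-involutive i y))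

flip-≢ : ∀ {n} i (x : Point n) → flip i x ≢ x
flip-≢ i x eq = not-¬ refl (sym (trans (sym (lookup-flip i x)) (cong (λ y → lookup y i) eq)))

flip-comm : ∀ {n} {i j : Fin n} → i ≢ j → (x : Point n) → flip i (flip j x) ≡ flip j (flip i x)
flip-comm {i = i} {j} i≢j x = updateAt-commutes i j i≢j x

same-or-opposite : ∀ a b → b ≡ a ⊎ b ≡ not a
same-or-opposite a b with b ≟ᵇ a
... | yes b≡a = inj₁ b≡a
... | no  b≢a = inj₂ (¬-not b≢a)

[]≔-injective-up-to-flip : ∀ {n} i {v} (x y : Point n) → x [ i ]≔ v ≡ y [ i ]≔ v → y ≡ x ⊎ y ≡ flip i x
[]≔-injective-up-to-flip zero    (a ∷ x) (b ∷ y) eq with refl ← ∷-injectiveʳ eq =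
  map⊎ (cong (_∷ x)) (cong (_∷ x)) (same-or-opposite a b)
[]≔-injective-up-to-flip (suc i) (a ∷ x) (b ∷ y) eq with refl , eq′ ← ∷-injective eq =
  map⊎ (cong (a ∷_)) (cong (a ∷_)) ([]≔-injective-up-to-flip i x y eq′)

firstFree : ∀ {n} → Subcube n → Maybe (Fin n)
firstFree []            = nothing
firstFree (nothing ∷ c) = just zero
firstFree (just _ ∷ c)  = Maybe.map suc (firstFree c)

firstFree-free : ∀ {n} (c : Subcube n) {i} → firstFree c ≡ just i → lookup c i ≡ nothing
firstFree-free (nothing ∷ c) refl = refl
firstFree-free (just _ ∷ c)  eq   with firstFree c in eq′
firstFree-free (just _ ∷ c)  refl | just i = firstFree-free c eq′

lowCorner : ∀ {n} → Subcube n → Point n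
lowCorner = Vec.map (fromMaybe false)

lowCorner-∈ᶜ : ∀ {n} (c : Subcube n) → lowCorner c ∈ᶜ c
lowCorner-∈ᶜ []            = tt
lowCorner-∈ᶜ (nothing ∷ c) = lowCorner-∈ᶜ c
lowCorner-∈ᶜ (just _ ∷ c)  = refl , lowCorner-∈ᶜ c

no-free⇒≡lowCorner : ∀ {n} (c : Subcube n) {x} → firstFree c ≡ nothing → x ∈ᶜ c → x ≡ lowCorner c
no-free⇒≡lowCorner []            {[]}    _  _          = refl
no-free⇒≡lowCorner (just _ ∷ c)  {_ ∷ x} eq (refl , x∈) with firstFree c in eq′
... | nothing = cong (_ ∷_) (no-free⇒≡lowCorner c eq′ x∈)

lowCorner-firstFree : ∀ {n} (c : Subcube n) →
  Maybe.map (lookup (lowCorner c)) (firstFree c) ≡ nothing ⊎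
  Maybe.map (lookup (lowCorner c)) (firstFree c) ≡ just false
lowCorner-firstFree c with firstFree c in eq
... | nothing = inj₁ refl
... | just i  = inj₂ (cong just (trans (lookup-map i _ c) (cong (fromMaybe false) (firstFree-free c eq))))

updateAt-∈ᶜ : ∀ {n} (c : Subcube n) i {f} (x : Point n) → lookup c i ≡ nothing → x ∈ᶜ c → updateAt x i f ∈ᶜ c
updateAt-∈ᶜ (nothing ∷ c) zero    (_ ∷ x) _    x∈          = x∈
updateAt-∈ᶜ (nothing ∷ c) (suc i) (_ ∷ x) free x∈          = updateAt-∈ᶜ c i x free x∈
updateAt-∈ᶜ (just _ ∷ c)  (suc i) (_ ∷ x) free (refl , x∈) = refl , updateAt-∈ᶜ c i x free x∈

∈ᶜ-point⁺ : ∀ {n} (x : Point n) → x ∈ᶜ Vec.map just x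
∈ᶜ-point⁺ []      = tt
∈ᶜ-point⁺ (b ∷ x) = refl , ∈ᶜ-point⁺ x

∈ᶜ-point⁻ : ∀ {n} (x : Point n) {y} → y ∈ᶜ Vec.map just x → y ≡ x
∈ᶜ-point⁻ []      {[]}    _           = refl
∈ᶜ-point⁻ (b ∷ x) {_ ∷ y} (refl , y∈) = cong (b ∷_) (∈ᶜ-point⁻ x y∈)

edge : ∀ {n} → Fin n → Point n → Subcube n
edge i x = Vec.map just x [ i ]≔ nothing

∈ᶜ-edge : ∀ {n} i (x : Point n) → x ∈ᶜ edge i x
∈ᶜ-edge zero    (b ∷ x) = ∈ᶜ-point⁺ x
∈ᶜ-edge (suc i) (b ∷ x) = refl , ∈ᶜ-edge i x

flip-∈ᶜ-edge : ∀ {n} i (x : Point n) → flip i x ∈ᶜ edge i x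
flip-∈ᶜ-edge i x = updateAt-∈ᶜ (edge i x) i x (lookup∘update i (Vec.map just x) nothing) (∈ᶜ-edge i x)

∈ᶜ-edge⁻ : ∀ {n} i (x : Point n) {y} → y ∈ᶜ edge i x → y ≡ x ⊎ y ≡ flip i x
∈ᶜ-edge⁻ zero    (b ∷ x) {a ∷ y} y∈ with refl ← ∈ᶜ-point⁻ x {y} y∈ =
  map⊎ (cong (_∷ x)) (cong (_∷ x)) (same-or-opposite b a)
∈ᶜ-edge⁻ (suc i) (b ∷ x) {_ ∷ y} (refl , y∈) = map⊎ (cong (b ∷_)) (cong (b ∷_)) (∈ᶜ-edge⁻ i x y∈)

pair : ∀ {m} → Fin m → Fin m → Subset m
pair zero    zero    = inside ∷ ∅
pair zero    (suc b) = inside ∷ ⁅ b ⁆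
pair (suc a) zero    = inside ∷ ⁅ a ⁆
pair (suc a) (suc b) = outside ∷ pair a b

∣pair∣≡2 : ∀ {m} {a b : Fin m} → a ≢ b → ∣ pair a b ∣ ≡ 2
∣pair∣≡2 {a = zero}  {zero}  a≢b = contradiction refl a≢b
∣pair∣≡2 {a = zero}  {suc b} _   = cong suc (∣⁅x⁆∣≡1 b)
∣pair∣≡2 {a = suc a} {zero}  _   = cong suc (∣⁅x⁆∣≡1 a)
∣pair∣≡2 {a = suc a} {suc b} a≢b = ∣pair∣≡2 (λ a≡b → a≢b (cong suc a≡b))

∈pairˡ : ∀ {m} (a b : Fin m) → a ∈ˢ pair a b
∈pairˡ zero    zero    = here
∈pairˡ zero    (suc b) = here
∈pairˡ (suc a) zero    = there (x∈⁅x⁆ a)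
∈pairˡ (suc a) (suc b) = there (∈pairˡ a b)

∈pairʳ : ∀ {m} (a b : Fin m) → b ∈ˢ pair a b
∈pairʳ zero    zero    = here
∈pairʳ zero    (suc b) = there (x∈⁅x⁆ b)
∈pairʳ (suc a) zero    = here
∈pairʳ (suc a) (suc b) = there (∈pairʳ a b)

∈pair⁻ : ∀ {m} (a b : Fin m) {c} → c ∈ˢ pair a b → c ≡ a ⊎ c ≡ b
∈pair⁻ zero    zero    here      = inj₁ refl
∈pair⁻ zero    zero    (there c∈) = contradiction c∈ ∉⊥
∈pair⁻ zero    (suc b) here      = inj₁ refl
∈pair⁻ zero    (suc b) (there c∈) = inj₂ (cong suc (x∈⁅y⁆⇒x≡y b c∈))
∈pair⁻ (suc a) zero    here      = inj₂ refl
∈pair⁻ (suc a) zero    (there c∈) = inj₁ (cong suc (x∈⁅y⁆⇒x≡y a c∈))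
∈pair⁻ (suc a) (suc b) (there c∈) = map⊎ (cong suc) (cong suc) (∈pair⁻ a b c∈)

-- punchOut made total; the value at j = i is junk.
punchOut′ : ∀ {k} → Fin (suc (suc k)) → Fin (suc (suc k)) → Fin (suc k)
punchOut′ i j with i ≟ᶠ j
... | yes _   = zero
... | no  i≢j = punchOut i≢j

punchOut′-injective : ∀ {k} {i j j′ : Fin (suc (suc k))} → i ≢ j → i ≢ j′ →
  punchOut′ i j ≡ punchOut′ i j′ → j ≡ j′
punchOut′-injective {i = i} {j} {j′} i≢j i≢j′ eq with i ≟ᶠ j | i ≟ᶠ j′
... | yes i≡j | _        = contradiction i≡j i≢j
... | no  _   | yes i≡j′ = contradiction i≡j′ i≢j′
... | no  p   | no  q    = punchOut-injective p q eq

many-cells-bound : ∀ K {m a l u} → a * suc K ≤ l * K → l ≤ u → m ≤ a + l →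
  m * (3 * suc K ∸ 1) ≤ (2 * suc K ∸ 1) * (a + l + u)
many-cells-bound K {m} {a} {l} {u} aK′≤lK l≤u m≤a+l = begin
  m * (3 * suc K ∸ 1)           ≤⟨ *-monoˡ-≤ _ m≤a+l ⟩
  (a + l) * (3 * suc K ∸ 1)     ≤⟨ +-cancelʳ-≤ (l * K) _ _ exchange ⟩
  (2 * suc K ∸ 1) * (a + l + l) ≤⟨ *-monoʳ-≤ (2 * suc K ∸ 1) (+-monoʳ-≤ (a + l) l≤u) ⟩
  (2 * suc K ∸ 1) * (a + l + u) ∎
  where
  open ≤-Reasoning
  -- The truncated subtractions 3 * suc K ∸ 1 and 2 * suc K ∸ 1 compute to K + 2 * suc K and
  -- K + 1 * suc K, which is how identity is used in exchange below.
  identity : (a + l) * (K + 2 * suc K) + l * K ≡ (K + 1 * suc K) * (a + l + l) + a * suc K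
  identity = solve (List ℕ ∋ a ∷ l ∷ K ∷ [])
  exchange : (a + l) * (3 * suc K ∸ 1) + l * K ≤ (2 * suc K ∸ 1) * (a + l + l) + l * K
  exchange = begin
    (a + l) * (3 * suc K ∸ 1) + l * K         ≡⟨ identity ⟩
    (2 * suc K ∸ 1) * (a + l + l) + a * suc K ≤⟨ +-monoʳ-≤ _ aK′≤lK ⟩
    (2 * suc K ∸ 1) * (a + l + l) + l * K     ∎

few-cells-bound : ∀ k {m} → m ≤ 2 → m * (3 * (2 + k) ∸ 1) ≤ (2 * (2 + k) ∸ 1) * 2 ^ (2 + k)
few-cells-bound k {m} m≤2 = begin
  m * (3 * (2 + k) ∸ 1)             ≤⟨ *-monoˡ-≤ _ m≤2 ⟩
  2 * (3 * (2 + k) ∸ 1)             ≤⟨ m≤m+n _ (2 * suc k) ⟩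
  2 * (3 * (2 + k) ∸ 1) + 2 * suc k ≡⟨ identity ⟩
  (2 * (2 + k) ∸ 1) * 2 ^ 2         ≤⟨ *-monoʳ-≤ (2 * (2 + k) ∸ 1) (^-monoʳ-≤ 2 {2} {2 + k} (s≤s (s≤s z≤n))) ⟩
  (2 * (2 + k) ∸ 1) * 2 ^ (2 + k)   ∎
  where
  open ≤-Reasoning
  identity : 2 * (suc k + 2 * (2 + k)) + 2 * suc k ≡ (suc k + 1 * (2 + k)) * 4
  identity = solve (List ℕ ∋ k ∷ [])

module PartitionCounting {k m} (F : Family (suc (suc k)) m) (partition : IsSubcubePartition F) where

  n : ℕ
  n = suc (suc k)

  cell : Point n → Fin m
  cell x = proj₁ (partition x)

  ∈-cell : ∀ x → x ∈ᶜ F (cell x)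
  ∈-cell x = proj₁ (proj₂ (partition x))

  cell-unique : ∀ {x j} → x ∈ᶜ F j → cell x ≡ j
  cell-unique {x} {j} x∈ = sym (proj₂ (proj₂ (partition x)) j x∈)

  dir : Point n → Maybe (Fin n)
  dir x = firstFree (F (cell x))

  freeBit : Point n → Maybe Bool
  freeBit x = Maybe.map (lookup x) (dir x)

  same-dir : ∀ {x y i j} → dir x ≡ just i → dir y ≡ just j → cell x ≡ cell y → i ≡ j
  same-dir dx dy cx≡cy = just-injective (trans (sym dx) (trans (cong (firstFree ∘ F) cx≡cy) dy))

  cell-updateAt : ∀ {x i} f → dir x ≡ just i → cell (updateAt x i f) ≡ cell x
  cell-updateAt {x} {i} f dx = cell-unique (updateAt-∈ᶜ (F (cell x)) i x (firstFree-free (F (cell x)) dx) (∈-cell x))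

  dir-updateAt : ∀ {x i} f → dir x ≡ just i → dir (updateAt x i f) ≡ just i
  dir-updateAt f dx = trans (cong (firstFree ∘ F) (cell-updateAt f dx)) dx

  freeBit-at : ∀ {x i} → dir x ≡ just i → freeBit x ≡ just (lookup x i)
  freeBit-at {x} dx = cong (Maybe.map (lookup x)) dx

  freeBit≡just⁻ : ∀ {x b} → freeBit x ≡ just b → ∃[ i ] dir x ≡ just i × lookup x i ≡ b
  freeBit≡just⁻ {x} eq with dir x
  ... | just i = i , refl , just-injective eq

  freeBit≡nothing⁻ : ∀ {x} → freeBit x ≡ nothing → dir x ≡ nothing
  freeBit≡nothing⁻ {x} eq with dir x
  ... | nothing = refl

  singleton-cell : ∀ {s} → freeBit s ≡ nothing → ∀ x → x ∈ᶜ F (cell s) → x ≡ s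
  singleton-cell {s} single x x∈ = trans (no-free⇒≡lowCorner (F (cell s)) d x∈)
                                       (sym (no-free⇒≡lowCorner (F (cell s)) d (∈-cell s)))
    where d = freeBit≡nothing⁻ single

  points singles lowers uppers : List (Point n)
  points = allPoints n
  singles = fibre freeBit nothing points
  lowers  = fibre freeBit (just false) points
  uppers  = fibre freeBit (just true) points

  points-by-freeBit : length singles + length lowers + length uppers ≡ 2 ^ n
  points-by-freeBit = trans (length-fibres freeBit points) (length-allPoints n)

  cells≤singles+lowers : m ≤ length singles + length lowers
  cells≤singles+lowers = subst₂ _≤_ (length-tabulate id) (length-++ singles)
    (injective⇒length-≤ (lowCorner ∘ F) (Unique.allFin⁺ m) (λ _ _ → lowCorner-injective) into)
    where
    cell-lowCorner : ∀ i → cell (lowCorner (F i)) ≡ i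
    cell-lowCorner i = cell-unique (lowCorner-∈ᶜ (F i))
    lowCorner-injective : ∀ {i j} → lowCorner (F i) ≡ lowCorner (F j) → i ≡ j
    lowCorner-injective {i} {j} eq = trans (sym (cell-lowCorner i)) (trans (cong cell eq) (cell-lowCorner j))
    freeBit-lowCorner : ∀ i → freeBit (lowCorner (F i)) ≡ Maybe.map (lookup (lowCorner (F i))) (firstFree (F i))
    freeBit-lowCorner i = cong (λ j → Maybe.map (lookup (lowCorner (F i))) (firstFree (F j))) (cell-lowCorner i)
    into : ∀ {i} → i ∈ allFin m → lowCorner (F i) ∈ singles ++ lowers
    into {i} _ with lowCorner-firstFree (F i)
    ... | inj₁ single = ∈-++⁺ˡ (∈-fibre⁺ (∈-allPoints _) (trans (freeBit-lowCorner i) single))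
    ... | inj₂ lower  = ∈-++⁺ʳ singles (∈-fibre⁺ (∈-allPoints _) (trans (freeBit-lowCorner i) lower))

  lowers≤uppers : length lowers ≤ length uppers
  lowers≤uppers = injective⇒length-≤ flipFree (Unique.filter⁺ _ (allPoints-unique n)) injective into
    where
    flipFree : Point n → Point n
    flipFree x = maybe′ (λ i → flip i x) x (dir x)
    lower⁻ : ∀ {x} → x ∈ lowers → ∃[ i ] dir x ≡ just i × lookup x i ≡ false
    lower⁻ x∈ = freeBit≡just⁻ (∈-fibre⁻ points x∈)
    flipFree-at : ∀ {x i} → dir x ≡ just i → flipFree x ≡ flip i x
    flipFree-at {x} dx = cong (maybe′ (λ i → flip i x) x) dx
    into : ∀ {x} → x ∈ lowers → flipFree x ∈ uppers
    into {x} x∈ with i , dx , xᵢ≡0 ← lower⁻ x∈ rewrite flipFree-at dx =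
      ∈-fibre⁺ (∈-allPoints _)
        (trans (freeBit-at (dir-updateAt not dx)) (cong just (trans (lookup-flip i x) (cong not xᵢ≡0))))
    injective : ∀ {x y} → x ∈ lowers → y ∈ lowers → flipFree x ≡ flipFree y → x ≡ y
    injective {x} {y} x∈ y∈ eq with i , dx , _ ← lower⁻ x∈ | j , dy , _ ← lower⁻ y∈
      rewrite flipFree-at dx | flipFree-at dy
      with refl ← same-dir dx dy (trans (sym (cell-updateAt not dx)) (trans (cong cell eq) (cell-updateAt not dy)))
      = flip-injective i eq

  module _ (irreducible : Irreducible F) (2<m : 2 < m) where

    singletons-nonadjacent : ∀ {s} j → freeBit s ≡ nothing → freeBit (flip j s) ≢ nothing
    singletons-nonadjacent {s} j single single′ =
      irreducible (pair a b) (subst (1 <_) (sym ∣G∣≡2) (s≤s (s≤s z≤n))) (subst (_< m) (sym ∣G∣≡2) 2<m)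
        (edge j s , λ x → mk⇔ (to x) (from x))
      where
      s′ = flip j s
      a = cell s
      b = cell s′
      a≢b : a ≢ b
      a≢b a≡b = flip-≢ j s (singleton-cell single s′ (subst (λ c → s′ ∈ᶜ F c) (sym a≡b) (∈-cell s′)))
      ∣G∣≡2 : ∣ pair a b ∣ ≡ 2
      ∣G∣≡2 = ∣pair∣≡2 a≢b
      to : ∀ x → x ∈ᶜ edge j s → ∃[ c ] c ∈ˢ pair a b × x ∈ᶜ F c
      to x x∈ with ∈ᶜ-edge⁻ j s {x} x∈
      ... | inj₁ refl = a , ∈pairˡ a b , ∈-cell s
      ... | inj₂ refl = b , ∈pairʳ a b , ∈-cell s′
      from : ∀ x → ∃[ c ] c ∈ˢ pair a b × x ∈ᶜ F c → x ∈ᶜ edge j s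
      from x (c , c∈ , x∈) with ∈pair⁻ a b c∈
      ... | inj₁ refl = subst (_∈ᶜ edge j s) (sym (singleton-cell single x x∈)) (∈ᶜ-edge j s)
      ... | inj₂ refl = subst (_∈ᶜ edge j s) (sym (singleton-cell single′ x x∈)) (flip-∈ᶜ-edge j s)

    neighbour-dir : ∀ {s} j → freeBit s ≡ nothing → ∃[ i ] dir (flip j s) ≡ just i × i ≢ j
    neighbour-dir {s} j single with dir (flip j s) in dy
    ... | nothing = contradiction (cong (Maybe.map _) dy) (singletons-nonadjacent j single)
    ... | just i  = i , refl , i≢j
      where
      i≢j : i ≢ j
      i≢j refl = contradiction (trans (sym (freeBit≡nothing⁻ single)) (trans (cong (firstFree ∘ F) same-cell) dy)) λ ()
        where
        same-cell : cell s ≡ cell (flip j s)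
        same-cell = subst (λ x → cell x ≡ cell (flip j s)) (flip-involutive j s) (cell-updateAt not dy)

    -- The fallback (s , zero) is junk: on singletons s the direction is defined (neighbour-dir).
    lowerNeighbour : Point n × Fin n → Point n × Fin (suc k)
    lowerNeighbour (s , j) = maybe′ (λ i → (flip j s [ i ]≔ false , punchOut′ i j)) (s , zero) (dir (flip j s))

    lowerNeighbour-at : ∀ {s j i} → dir (flip j s) ≡ just i →
      lowerNeighbour (s , j) ≡ (flip j s [ i ]≔ false , punchOut′ i j)
    lowerNeighbour-at {s} dy = cong (maybe′ _ (s , zero)) dy

    lowerNeighbour-injective : ∀ {s j s′ j′} → freeBit s ≡ nothing → freeBit s′ ≡ nothing →
      lowerNeighbour (s , j) ≡ lowerNeighbour (s′ , j′) → (s , j) ≡ (s′ , j′)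
    lowerNeighbour-injective {s} {j} {s′} {j′} single single′ eq
      with i , dy , i≢j ← neighbour-dir j single | i′ , dy′ , i′≢j′ ← neighbour-dir j′ single′
      rewrite lowerNeighbour-at dy | lowerNeighbour-at dy′
      with refl ← same-dir dy dy′ (trans (sym (cell-updateAt (const false) dy))
                                   (trans (cong (cell ∘ proj₁) eq) (cell-updateAt (const false) dy′)))
      with refl ← punchOut′-injective i≢j i′≢j′ (cong proj₂ eq)
      with []≔-injective-up-to-flip i (flip j s) (flip j s′) (cong proj₁ eq)
    ... | inj₁ same     = cong (_, j) (sym (flip-injective j same))
    ... | inj₂ opposite = contradiction (subst (λ x → freeBit x ≡ nothing) s′≡flip-i-s single′)
                                        (singletons-nonadjacent i single)
      where
      s′≡flip-i-s : s′ ≡ flip i s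
      s′≡flip-i-s = flip-injective j (trans opposite (flip-comm i≢j s))

    singles*n≤lowers*k : length singles * n ≤ length lowers * suc k
    singles*n≤lowers*k = subst₂ _≤_ (length-×-allFin singles) (length-×-allFin lowers)
      (injective⇒length-≤ lowerNeighbour
        (Unique.cartesianProduct⁺ (Unique.filter⁺ _ (allPoints-unique n)) (Unique.allFin⁺ n))
        (λ p q → lowerNeighbour-injective (single p) (single q)) into)
      where
      single : ∀ {s j} → (s , j) ∈ cartesianProduct singles (allFin n) → freeBit s ≡ nothing
      single p = ∈-fibre⁻ points (proj₁ (∈-cartesianProduct⁻ singles (allFin n) p))
      into : ∀ {sj} → sj ∈ cartesianProduct singles (allFin n) → lowerNeighbour sj ∈ cartesianProduct lowers (allFin (suc k))
      into {s , j} p with i , dy , _ ← neighbour-dir j (single p) rewrite lowerNeighbour-at dy =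
        ∈-cartesianProduct⁺
          (∈-fibre⁺ (∈-allPoints _)
            (trans (freeBit-at (dir-updateAt (const false) dy)) (cong just (lookup∘update i (flip j s) false))))
          (∈-allFin _)

    partition-bound : m * (3 * n ∸ 1) ≤ (2 * n ∸ 1) * 2 ^ n
    partition-bound = subst (λ p → m * (3 * n ∸ 1) ≤ (2 * n ∸ 1) * p) points-by-freeBit
      (many-cells-bound (suc k) singles*n≤lowers*k lowers≤uppers cells≤singles+lowers)

theorem2p39 : ∀ (n m : ℕ) → 3 ≤ n → (F : Family n m) →
    IsSubcubePartition F → Irreducible F →
    m * (3 * n ∸ 1) ≤ (2 * n ∸ 1) * 2 ^ n
theorem2p39 (suc (suc (suc k))) m (s≤s (s≤s (s≤s z≤n))) F partition irreducible with m ≤? 2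
... | yes m≤2 = few-cells-bound (suc k) m≤2
... | no  m≰2 = PartitionCounting.partition-bound F partition irreducible (≰⇒> m≰2)
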